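{- The minions $\mathrm{Pol}(\mathbf Q_{\text{conv}})$ and $\mathcal Q_{\text{conv}}$ are isomorphic.
   Context: $\mathbf Q_{\text{conv}}$ is the single-sorted relational structure with domain $\mathbb Q$ and relations $\{(x,y):x\le y\}$, $\{(x_1,x_2,y):x_1+x_2=y\}$ and $\{1\}$. Minions: an (abstract) minion $\mathcal M$ assigns to each finite set $X$ a set $\mathcal M^{(X)}$ (empty iff $X=\emptyset$) and to each $\pi\colon X\to Y$ a map $f\mapsto f^\pi$, $\mathcal M^{(X)}\to\mathcal M^{(Y)}$, with $f^{1_X}=f$ and $(f^\sigma)^\pi=f^{\pi\circ\sigma}$. A minion homomorphism $\xi\colon\mathcal M\to\mathcal N$ is a family $\xi_X\colon\mathcal M^{(X)}\to\mathcal N^{(X)}$ with $\xi_Y(f^\pi)=\xi_X(f)^\pi$; an isomorphism is a minion homomorphism with an inverse minion homomorphism. $\mathrm{Pol}(\mathbf Q_{\text{conv}})^{(X)}$ is the set of homomorphisms $f\colon\mathbf Q_{\text{conv}}^X\to\mathbf Q_{\text{conv}}$ (maps $\mathbb Q^X\to\mathbb Q$ preserving the three relations coordinatewise), with $f^\pi(x)=f(x\circ\pi)$ for $x\in\mathbb Q^Y$. $\mathcal Q_{\text{conv}}^{(X)}$ is the set of functions $\lambda\colon X\to\mathbb Q$ with $\lambda(x)\ge0$ for all $x$ and $\sum_{x\in X}\lambda(x)=1$, with $\lambda^\pi(y)=\sum_{x\in\pi^{ -1}(y)}\lambda(x)$. -}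

module Defs where

open import Level using (Level; suc; _⊔_)
open import Data.Nat using (ℕ; zero; suc)
open import Data.Fin as Fin using (Fin)
open import Data.Rational using (ℚ; 0ℚ; 1ℚ; _+_; _≤_)
open import Data.Bool using (if_then_else_)
open import Relation.Nullary using (does)
open import Relation.Binary.PropositionalEquality using (_≡_)
open import Data.Product using (_×_)

-- Finite sets X are represented by their skeleton Fin n; maps X → Y by Fin n → Fin m.

-- Minions, presented by raw carriers with a membership predicate.
-- El n   : raw carrier, Ok n : which raw elements belong to M^(n),
-- _≈_    : equality of elements, minor π : the map f ↦ f^π.

record Minion : Set₁ where
  field
    El    : ℕ → Set
    Ok    : ∀ {n} → El n → Set
    _≈_   : ∀ {n} → El n → El n → Set
    minor : ∀ {n m} → (Fin n → Fin m) → El n → El m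

record IsMinionHom (M N : Minion) (ξ : ∀ {n} → Minion.El M n → Minion.El N n) : Set where
  private
    module M = Minion M
    module N = Minion N
  field
    ok   : ∀ {n} (f : M.El n) → M.Ok f → N.Ok (ξ f)
    cong : ∀ {n} (f g : M.El n) → M.Ok f → M.Ok g → f M.≈ g → ξ f N.≈ ξ g
    nat  : ∀ {n m} (π : Fin n → Fin m) (f : M.El n) → M.Ok f →
           ξ (M.minor π f) N.≈ N.minor π (ξ f)

record MinionIso (M N : Minion) : Set where
  private
    module M = Minion M
    module N = Minion N
  field
    to      : ∀ {n} → M.El n → N.El n
    from    : ∀ {n} → N.El n → M.El n
    to-hom   : IsMinionHom M N to
    from-hom : IsMinionHom N M from
    from∘to : ∀ {n} (f : M.El n) → M.Ok f → from (to f) M.≈ f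
    to∘from : ∀ {n} (g : N.El n) → N.Ok g → to (from g) N.≈ g

-- f : ℚ^n → ℚ is a polymorphism of Q_conv (preserves ≤, the addition
-- relation {(x1,x2,y) : x1+x2=y}, and the unary relation {1}).
IsPolQconv : ∀ {n} → ((Fin n → ℚ) → ℚ) → Set
IsPolQconv {n} f =
  (∀ (x y : Fin n → ℚ) → (∀ i → x i ≤ y i) → f x ≤ f y) ×
  (∀ (x₁ x₂ y : Fin n → ℚ) → (∀ i → x₁ i + x₂ i ≡ y i) → f x₁ + f x₂ ≡ f y) ×
  (∀ (x : Fin n → ℚ) → (∀ i → x i ≡ 1ℚ) → f x ≡ 1ℚ)

PolQconv : Minion
PolQconv = record
  { El    = λ n → (Fin n → ℚ) → ℚ
  ; Ok    = IsPolQconv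
  ; _≈_   = λ f g → ∀ x → f x ≡ g x
  ; minor = λ π f x → f (λ i → x (π i))
  }

sumℚ : ∀ {n} → (Fin n → ℚ) → ℚ
sumℚ {zero}  f = 0ℚ
sumℚ {suc n} f = f Fin.zero + sumℚ (λ i → f (Fin.suc i))

pushforward : ∀ {n m} → (Fin n → Fin m) → (Fin n → ℚ) → Fin m → ℚ
pushforward π l y = sumℚ (λ x → if does (π x Fin.≟ y) then l x else 0ℚ)

IsQconv : ∀ {n} → (Fin n → ℚ) → Set
IsQconv l = (∀ i → 0ℚ ≤ l i) × (sumℚ l ≡ 1ℚ)

Qconv : Minion
Qconv = record
  { El    = λ n → Fin n → ℚ
  ; Ok    = IsQconv
  ; _≈_   = λ l k → ∀ i → l i ≡ k i
  ; minor = pushforward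
  }

-- A polymorphism f of Q_conv is additive on ℚⁿ, and an additive map between ℚ-vector
-- spaces is ℚ-linear, so f x = Σᵢ cᵢ xᵢ with cᵢ = f(eᵢ).  Preservation of ≤ (compare eᵢ
-- with 0) makes every cᵢ nonnegative and preservation of 1 makes the cᵢ sum to 1.
-- Conversely every convex combination is a polymorphism, and the minor f ↦ f^π, i.e.
-- x ↦ f (x ∘ π), has coefficients Σ_{π i = j} cᵢ, the pushforward of c along π.
module Submission where

open import Defs

open import Algebra.Bundles using (CommutativeRing)
open import Data.Bool using (true; false; if_then_else_)
open import Data.Fin using (Fin; zero; suc; _≟_)
open import Data.Integer as ℤ using (+_; -[1+_])
import Data.Integer.Properties as ℤ
open import Data.Nat as ℕ using (zero; suc)
import Data.Nat.Properties as ℕ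
open import Data.Product using (_,_; proj₁; proj₂)
open import Data.Rational
  using (ℚ; 0ℚ; 1ℚ; _+_; _*_; -_; _≤_; ↥_; ↧_; mkℚ; NonZero; 1/_; toℚᵘ; nonNegative)
open import Data.Rational.Literals using (fromℤ)
open import Data.Rational.Properties hiding (_≟_)
import Data.Rational.Unnormalised as ℚᵘ
import Data.Rational.Unnormalised.Properties as ℚᵘ
open import Function.Bundles using (mk⇔)
open import Relation.Binary.PropositionalEquality
open import Relation.Nullary.Decidable using (does; does-⇔)

open import Algebra.Properties.Group +-0-group using (identityʳ-unique; inverseʳ-unique)
open import Algebra.Properties.Semiring.Sum (CommutativeRing.semiring +-*-commutativeRing)
  using (sum; sum-cong-≗; sum-replicate-zero; ∑-distrib-+; ∑-comm; *-distribʳ-sum)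

open ≡-Reasoning

fromℤ-suc : ∀ n → fromℤ (+ suc n) ≡ 1ℚ + fromℤ (+ n)
fromℤ-suc n =
  toℚᵘ-injective (ℚᵘ.≃-sym (ℚᵘ.≃-trans (toℚᵘ-homo-+ 1ℚ (fromℤ (+ n))) (ℚᵘ.*≡* eq)))
  where
  eq : (+ 1 ℤ.+ + n ℤ.* + 1) ℤ.* + 1 ≡ + suc n ℤ.* + 1
  eq rewrite ℤ.*-identityʳ (+ n) = refl

fromℤ↧p*p≡fromℤ↥p : ∀ p → fromℤ (↧ p) * p ≡ fromℤ (↥ p)
fromℤ↧p*p≡fromℤ↥p p@(mkℚ n d-1 _) =
  toℚᵘ-injective (ℚᵘ.≃-trans (toℚᵘ-homo-* (fromℤ (↧ p)) p) (ℚᵘ.*≡* eq))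
  where
  eq : (+ suc d-1 ℤ.* n) ℤ.* + 1 ≡ n ℤ.* + suc (d-1 ℕ.+ 0)
  eq rewrite ℕ.+-identityʳ d-1 = trans (ℤ.*-identityʳ _) (ℤ.*-comm (+ suc d-1) n)

*-cancelˡ-≡ : ∀ r .{{_ : NonZero r}} {p q} → r * p ≡ r * q → p ≡ q
*-cancelˡ-≡ r {p} {q} r*p≡r*q = begin
  p                ≡⟨ *-identityˡ p ⟨
  1ℚ * p           ≡⟨ cong (_* p) (*-inverseˡ r) ⟨
  (1/ r * r) * p   ≡⟨ *-assoc (1/ r) r p ⟩
  1/ r * (r * p)   ≡⟨ cong (1/ r *_) r*p≡r*q ⟩
  1/ r * (r * q)   ≡⟨ *-assoc (1/ r) r q ⟨
  (1/ r * r) * q   ≡⟨ cong (_* q) (*-inverseˡ r) ⟩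
  1ℚ * q           ≡⟨ *-identityˡ q ⟩
  q                ∎

module _ (g : ℚ → ℚ) (g-+ : ∀ p q → g (p + q) ≡ g p + g q) where

  private
    g-0 : g 0ℚ ≡ 0ℚ
    g-0 = identityʳ-unique (g 0ℚ) (g 0ℚ) (sym (g-+ 0ℚ 0ℚ))

    g-neg : ∀ p → g (- p) ≡ - g p
    g-neg p = inverseʳ-unique (g p) (g (- p))
      (trans (sym (g-+ p (- p))) (trans (cong g (+-inverseʳ p)) g-0))

    g-fromℕ* : ∀ n p → g (fromℤ (+ n) * p) ≡ fromℤ (+ n) * g p
    g-fromℕ* zero    p = trans (cong g (*-zeroˡ p)) (trans g-0 (sym (*-zeroˡ (g p))))
    g-fromℕ* (suc n) p = begin
      g (fromℤ (+ suc n) * p)          ≡⟨ cong (λ r → g (r * p)) (fromℤ-suc n) ⟩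
      g ((1ℚ + fromℤ (+ n)) * p)       ≡⟨ cong g (*-distribʳ-+ p 1ℚ (fromℤ (+ n))) ⟩
      g (1ℚ * p + fromℤ (+ n) * p)     ≡⟨ g-+ (1ℚ * p) (fromℤ (+ n) * p) ⟩
      g (1ℚ * p) + g (fromℤ (+ n) * p) ≡⟨ cong₂ _+_ (cong g (*-identityˡ p)) (g-fromℕ* n p) ⟩
      g p + fromℤ (+ n) * g p          ≡⟨ cong (_+ fromℤ (+ n) * g p) (*-identityˡ (g p)) ⟨
      1ℚ * g p + fromℤ (+ n) * g p     ≡⟨ *-distribʳ-+ (g p) 1ℚ (fromℤ (+ n)) ⟨
      (1ℚ + fromℤ (+ n)) * g p         ≡⟨ cong (_* g p) (fromℤ-suc n) ⟨
      fromℤ (+ suc n) * g p            ∎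

    g-fromℤ* : ∀ z p → g (fromℤ z * p) ≡ fromℤ z * g p
    g-fromℤ* (+ n)    p = g-fromℕ* n p
    g-fromℤ* -[1+ n ] p = begin
      g (- fromℤ (+ suc n) * p)        ≡⟨ cong g (neg-distribˡ-* (fromℤ (+ suc n)) p) ⟨
      g (- (fromℤ (+ suc n) * p))      ≡⟨ g-neg (fromℤ (+ suc n) * p) ⟩
      - g (fromℤ (+ suc n) * p)        ≡⟨ cong -_ (g-fromℕ* (suc n) p) ⟩
      - (fromℤ (+ suc n) * g p)        ≡⟨ neg-distribˡ-* (fromℤ (+ suc n)) (g p) ⟩
      - fromℤ (+ suc n) * g p          ∎

  -- Multiplying by the denominator reduces the claim to integers, where it is additivity.
  additive⇒linear : ∀ p → g p ≡ p * g 1ℚ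
  additive⇒linear p = *-cancelˡ-≡ d (begin
    d * g p                ≡⟨ g-fromℤ* (↧ p) p ⟨
    g (d * p)              ≡⟨ cong g (fromℤ↧p*p≡fromℤ↥p p) ⟩
    g (fromℤ (↥ p))        ≡⟨ cong g (*-identityʳ (fromℤ (↥ p))) ⟨
    g (fromℤ (↥ p) * 1ℚ)   ≡⟨ g-fromℤ* (↥ p) 1ℚ ⟩
    fromℤ (↥ p) * g 1ℚ     ≡⟨ cong (_* g 1ℚ) (fromℤ↧p*p≡fromℤ↥p p) ⟨
    (d * p) * g 1ℚ         ≡⟨ *-assoc d p (g 1ℚ) ⟩
    d * (p * g 1ℚ)         ∎)
    where
    d : ℚ
    d = fromℤ (↧ p)

sumℚ≡sum : ∀ {n} (f : Fin n → ℚ) → sumℚ f ≡ sum f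
sumℚ≡sum {zero}  f = refl
sumℚ≡sum {suc n} f = cong (_+_ (f zero)) (sumℚ≡sum (λ i → f (suc i)))

sum-mono-≤ : ∀ {n} {f g : Fin n → ℚ} → (∀ i → f i ≤ g i) → sum f ≤ sum g
sum-mono-≤ {zero}  f≤g = ≤-refl
sum-mono-≤ {suc n} f≤g = +-mono-≤ (f≤g zero) (sum-mono-≤ (λ i → f≤g (suc i)))

sum-select : ∀ {n} (k : Fin n) (f : Fin n → ℚ) →
             sum (λ i → if does (k ≟ i) then f i else 0ℚ) ≡ f k
sum-select {suc n} zero    f = trans (cong (_+_ (f zero)) (sum-replicate-zero n)) (+-identityʳ _)
sum-select {suc n} (suc k) f = trans (+-identityˡ _) (sum-select k (λ i → f (suc i)))

does-≟-sym : ∀ {n} (i j : Fin n) → does (i ≟ j) ≡ does (j ≟ i)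
does-≟-sym i j = does-⇔ (mk⇔ sym sym) (i ≟ j) (j ≟ i)

*-if : ∀ b p → p * (if b then 1ℚ else 0ℚ) ≡ (if b then p else 0ℚ)
*-if true  p = *-identityʳ p
*-if false p = *-zeroʳ p

if-* : ∀ b p q → (if b then p else 0ℚ) * q ≡ (if b then p * q else 0ℚ)
if-* true  p q = refl
if-* false p q = *-zeroˡ q

basis : ∀ {n} → Fin n → Fin n → ℚ
basis i j = if does (j ≟ i) then 1ℚ else 0ℚ

basis-nonNeg : ∀ {n} (i j : Fin n) → 0ℚ ≤ basis i j
basis-nonNeg i j with does (j ≟ i)
... | true  = nonNegative⁻¹ 1ℚ
... | false = ≤-refl

basis-decomposition : ∀ {n} (x : Fin n → ℚ) j → x j ≡ sum (λ i → x i * basis i j)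
basis-decomposition x j = sym (begin
  sum (λ i → x i * basis i j)                        ≡⟨ sum-cong-≗ (λ i → *-if (does (j ≟ i)) (x i)) ⟩
  sum (λ i → if does (j ≟ i) then x i else 0ℚ)     ≡⟨ sum-select j x ⟩
  x j                                                ∎)

coefficients : ∀ {n} → ((Fin n → ℚ) → ℚ) → Fin n → ℚ
coefficients f i = f (basis i)

linearForm : ∀ {n} → (Fin n → ℚ) → (Fin n → ℚ) → ℚ
linearForm c x = sum (λ i → c i * x i)

coefficients-linearForm : ∀ {n} (c : Fin n → ℚ) i → coefficients (linearForm c) i ≡ c i
coefficients-linearForm c i = begin
  sum (λ j → c j * basis i j)                        ≡⟨ sum-cong-≗ (λ j → *-if (does (j ≟ i)) (c j)) ⟩
  sum (λ j → if does (j ≟ i) then c j else 0ℚ)     ≡⟨ sum-cong-≗ (λ j → cong (if_then c j else 0ℚ) (does-≟-sym j i)) ⟩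
  sum (λ j → if does (i ≟ j) then c j else 0ℚ)     ≡⟨ sum-select i c ⟩
  c i                                                ∎

module Polymorphism {n} {f : (Fin n → ℚ) → ℚ} (f-pol : IsPolQconv f) where

  private
    f-mono : ∀ x y → (∀ i → x i ≤ y i) → f x ≤ f y
    f-mono = proj₁ f-pol

    f-+ : ∀ x y → f (λ i → x i + y i) ≡ f x + f y
    f-+ x y = sym (proj₁ (proj₂ f-pol) x y _ (λ _ → refl))

    f-1 : f (λ _ → 1ℚ) ≡ 1ℚ
    f-1 = proj₂ (proj₂ f-pol) _ (λ _ → refl)

    -- There is no function extensionality; antisymmetry of ≤ gives congruence instead.
    f-cong : ∀ {x y} → (∀ i → x i ≡ y i) → f x ≡ f y
    f-cong x≗y = ≤-antisym (f-mono _ _ (λ i → ≤-reflexive (x≗y i)))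
                           (f-mono _ _ (λ i → ≤-reflexive (sym (x≗y i))))

    f-0 : f (λ _ → 0ℚ) ≡ 0ℚ
    f-0 = identityʳ-unique (f (λ _ → 0ℚ)) (f (λ _ → 0ℚ)) (sym (f-+ (λ _ → 0ℚ) (λ _ → 0ℚ)))

    f-sum : ∀ m (v : Fin m → Fin n → ℚ) → f (λ j → sum (λ i → v i j)) ≡ sum (λ i → f (v i))
    f-sum zero    v = f-0
    f-sum (suc m) v = trans (f-+ (v zero) _) (cong (_+_ (f (v zero))) (f-sum m (λ i → v (suc i))))

    f-scale : ∀ p x → f (λ j → p * x j) ≡ p * f x
    f-scale p x = trans
      (additive⇒linear (λ q → f (λ j → q * x j))
        (λ q r → trans (f-cong (λ j → *-distribʳ-+ (x j) q r)) (f-+ _ _)) p)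
      (cong (p *_) (f-cong (λ j → *-identityˡ (x j))))

  linearForm-coefficients : ∀ x → linearForm (coefficients f) x ≡ f x
  linearForm-coefficients x = sym (begin
    f x                                        ≡⟨ f-cong (basis-decomposition x) ⟩
    f (λ j → sum (λ i → x i * basis i j))      ≡⟨ f-sum n (λ i j → x i * basis i j) ⟩
    sum (λ i → f (λ j → x i * basis i j))      ≡⟨ sum-cong-≗ (λ i → f-scale (x i) (basis i)) ⟩
    sum (λ i → x i * coefficients f i)         ≡⟨ sum-cong-≗ (λ i → *-comm (x i) _) ⟩
    linearForm (coefficients f) x              ∎)

  coefficients-nonNeg : ∀ i → 0ℚ ≤ coefficients f i
  coefficients-nonNeg i = ≤-trans (≤-reflexive (sym f-0)) (f-mono _ _ (basis-nonNeg i))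

  coefficients-sum : sum (coefficients f) ≡ 1ℚ
  coefficients-sum = begin
    sum (coefficients f)                       ≡⟨ sum-cong-≗ (λ i → *-identityʳ (coefficients f i)) ⟨
    linearForm (coefficients f) (λ _ → 1ℚ)     ≡⟨ linearForm-coefficients _ ⟩
    f (λ _ → 1ℚ)                               ≡⟨ f-1 ⟩
    1ℚ                                         ∎

  coefficients-minor : ∀ {m} (π : Fin n → Fin m) j →
                       coefficients (Minion.minor PolQconv π f) j ≡ pushforward π (coefficients f) j
  coefficients-minor π j = begin
    f (λ i → basis j (π i))                                         ≡⟨ linearForm-coefficients _ ⟨
    sum (λ i → coefficients f i * basis j (π i))                    ≡⟨ sum-cong-≗ (λ i → *-if (does (π i ≟ j)) _) ⟩
    sum (λ i → if does (π i ≟ j) then coefficients f i else 0ℚ)   ≡⟨ sumℚ≡sum {n} _ ⟨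
    pushforward π (coefficients f) j                                ∎

convex-linearForm-isPol : ∀ {n} {c : Fin n → ℚ} → IsQconv c → IsPolQconv (linearForm c)
convex-linearForm-isPol {c = c} (c≥0 , Σc≡1) = mono , additive , unit
  where
  mono : ∀ x y → (∀ i → x i ≤ y i) → linearForm c x ≤ linearForm c y
  mono x y x≤y = sum-mono-≤ (λ i → *-monoˡ-≤-nonNeg (c i) {{nonNegative (c≥0 i)}} (x≤y i))

  additive : ∀ x₁ x₂ y → (∀ i → x₁ i + x₂ i ≡ y i) →
             linearForm c x₁ + linearForm c x₂ ≡ linearForm c y
  additive x₁ x₂ y x₁+x₂≡y = begin
    linearForm c x₁ + linearForm c x₂        ≡⟨ ∑-distrib-+ (λ i → c i * x₁ i) (λ i → c i * x₂ i) ⟨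
    sum (λ i → c i * x₁ i + c i * x₂ i)      ≡⟨ sum-cong-≗ (λ i → *-distribˡ-+ (c i) (x₁ i) (x₂ i)) ⟨
    sum (λ i → c i * (x₁ i + x₂ i))          ≡⟨ sum-cong-≗ (λ i → cong (c i *_) (x₁+x₂≡y i)) ⟩
    linearForm c y                           ∎

  unit : ∀ x → (∀ i → x i ≡ 1ℚ) → linearForm c x ≡ 1ℚ
  unit x x≡1 = begin
    linearForm c x      ≡⟨ sum-cong-≗ (λ i → trans (cong (c i *_) (x≡1 i)) (*-identityʳ (c i))) ⟩
    sum c               ≡⟨ sumℚ≡sum c ⟨
    sumℚ c              ≡⟨ Σc≡1 ⟩
    1ℚ                  ∎

linearForm-pushforward : ∀ {n m} (π : Fin n → Fin m) (c : Fin n → ℚ) x →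
                         linearForm (pushforward π c) x ≡ linearForm c (λ i → x (π i))
linearForm-pushforward {n} {m} π c x = begin
  sum (λ j → pushforward π c j * x j)             ≡⟨ sum-cong-≗ (λ j → cong (_* x j) (sumℚ≡sum (fibre j))) ⟩
  sum (λ j → sum (fibre j) * x j)                 ≡⟨ sum-cong-≗ (λ j → *-distribʳ-sum (x j) (fibre j)) ⟩
  sum (λ j → sum (λ i → fibre j i * x j))         ≡⟨ ∑-comm (λ j i → fibre j i * x j) ⟩
  sum (λ i → sum (λ j → fibre j i * x j))         ≡⟨ sum-cong-≗ (λ i → sum-cong-≗ (λ j → if-* (does (π i ≟ j)) (c i) (x j))) ⟩
  sum (λ i → sum (λ j → if does (π i ≟ j) then c i * x j else 0ℚ))
                                                  ≡⟨ sum-cong-≗ (λ i → sum-select (π i) (λ j → c i * x j)) ⟩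
  linearForm c (λ i → x (π i))                    ∎
  where
  fibre : Fin m → Fin n → ℚ
  fibre j i = if does (π i ≟ j) then c i else 0ℚ

coefficients-isMinionHom : IsMinionHom PolQconv Qconv coefficients
coefficients-isMinionHom = record
  { ok   = λ f f-pol → let open Polymorphism f-pol in
             coefficients-nonNeg , trans (sumℚ≡sum (coefficients f)) coefficients-sum
  ; cong = λ f g _ _ f≗g i → f≗g (basis i)
  ; nat  = λ π f f-pol → Polymorphism.coefficients-minor f-pol π
  }

linearForm-isMinionHom : IsMinionHom Qconv PolQconv linearForm
linearForm-isMinionHom = record
  { ok   = λ c → convex-linearForm-isPol
  ; cong = λ c d _ _ c≗d x → sum-cong-≗ (λ i → cong (_* x i) (c≗d i))
  ; nat  = λ π c _ → linearForm-pushforward π c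
  }

lemmaD1 : MinionIso PolQconv Qconv
lemmaD1 = record
  { to       = coefficients
  ; from     = linearForm
  ; to-hom   = coefficients-isMinionHom
  ; from-hom = linearForm-isMinionHom
  ; from∘to  = λ f f-pol → Polymorphism.linearForm-coefficients f-pol
  ; to∘from  = λ c _ → coefficients-linearForm c
  }
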